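{- Let $d\in\mathbb{Z}$ and let $f(x)=1-x-dx^{2}+\sum_{k\geq3}a_{k}x^{k}$ be a formal power series with all coefficients $a_k\in\mathbb{Z}$. Let $(m_k)_{k\geq1}$ and $(n_k)_{k\geq1}$ be the unique sequences of integers such that, as formal power series, \[ f(x)=\prod_{k\geq1}(1-m_{k}x^{k}),\qquad \frac{1}{f(x)}=\prod_{k\geq1}(1-n_{k}x^{k}). \] Then $m_k=-n_k$ for every odd positive integer $k$.
   Context: Every formal power series with integer coefficients and constant term $1$ can be written uniquely as a formal infinite product $\prod_{k\geq1}(1-c_kx^k)$ with $c_k\in\mathbb{Z}$; the sequences $(m_k)$ and $(n_k)$ are the sequences so obtained for $f$ and $1/f$ respectively. -}

module Defs where

open import Data.Nat using (ℕ; zero; suc; _∸_; _≡ᵇ_)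
open import Data.Integer using (ℤ; +_; -_; _+_; _*_)
open import Data.Bool using (if_then_else_)

-- Formal power series with integer coefficients: n ↦ coefficient of x^n.
Series : Set
Series = ℕ → ℤ

sumTo : ℕ → (ℕ → ℤ) → ℤ
sumTo zero    g = g zero
sumTo (suc n) g = sumTo n g + g (suc n)

_⊛_ : Series → Series → Series
(f ⊛ g) n = sumTo n (λ i → f i * g (n ∸ i))

one : Series
one zero    = + 1
one (suc _) = + 0

-- The polynomial 1 - c x^k (intended for k ≥ 1).
factor : ℤ → ℕ → Series
factor c k zero    = + 1
factor c k (suc n) = if k ≡ᵇ suc n then - c else + 0

-- Finite product ∏_{k=1}^{N} (1 - c k x^k).  (c 0 is never used.)
partialProd : (ℕ → ℤ) → ℕ → Series
partialProd c zero    = one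
partialProd c (suc N) = partialProd c N ⊛ factor (c (suc N)) (suc N)

-- Formal infinite product ∏_{k≥1} (1 - c k x^k): the coefficient of x^n
-- only depends on the factors with k ≤ n.
infProd : (ℕ → ℤ) → Series
infProd c n = partialProd c n n

module Submission where

-- Write P_M = ∏_{k≤M} (1 - m_k x^k) and Q_M = ∏_{k≤M} (1 - n_k x^k).
-- Since f = ∏ (1 - m_k x^k) and f·∏ (1 - n_k x^k) = 1, the series P_N·Q_N agrees
-- with 1 up to x^N.  Multiplying by one pair of factors with the same exponent k
-- gives
--     (P·(1 - a x^k))·(Q·(1 - b x^k)) = PQ·(1 - (a+b) x^k + ab x^{2k}).
-- If PQ is an even series (all odd coefficients vanish), then so is the right
-- hand side whenever k is even, or k is odd and a + b = 0.  By strong induction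
-- on N: if m_k + n_k = 0 for all odd k < N, then P_{N-1}Q_{N-1} is even, and for
-- odd N the coefficient of x^N in P_N Q_N is -(m_N + n_N), which must be 0.
-- Hence m_k = -n_k for all odd k; the particular coefficients of f play no role.

open import Defs
open import Data.Nat using (ℕ; zero; suc; _*_)
open import Data.Integer using (ℤ; +_; -_; -[1+_])
open import Relation.Binary.PropositionalEquality using (_≡_)

open import Data.Nat as ℕ using (parity; _∸_; _≤_; _<_; z≤n; s≤s; _≡ᵇ_)
import Data.Nat.Properties as ℕP
open import Data.Integer as ℤ using (_+_)
import Data.Integer.Properties as ℤP
open import Data.Integer.Tactic.RingSolver using (solve-∀)
open import Algebra.Properties.AbelianGroup ℤP.+-0-abelianGroup using (inverseˡ-unique)
open import Data.Parity.Base as ℙ using (Parity; 0ℙ; 1ℙ; _⁻¹)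
import Data.Parity.Properties as ℙP
open import Data.Bool using (true; false; if_then_else_)
open import Data.Sum using (inj₁; inj₂)
open import Relation.Binary.PropositionalEquality using (refl; sym; trans; cong; cong₂; subst; module ≡-Reasoning)
open ≡-Reasoning

sumTo-cong : ∀ n {g h : ℕ → ℤ} → (∀ i → i ≤ n → g i ≡ h i) → sumTo n g ≡ sumTo n h
sumTo-cong zero    eq = eq 0 z≤n
sumTo-cong (suc n) eq =
  cong₂ _+_ (sumTo-cong n (λ i p → eq i (ℕP.m≤n⇒m≤1+n p))) (eq (suc n) ℕP.≤-refl)

sumTo-peel : ∀ n (g : ℕ → ℤ) → sumTo (suc n) g ≡ g 0 + sumTo n (λ i → g (suc i))
sumTo-peel zero    g = refl
sumTo-peel (suc n) g = trans (cong (_+ g (suc (suc n))) (sumTo-peel n g))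
                             (ℤP.+-assoc (g 0) _ (g (suc (suc n))))

sumTo-reverse : ∀ n (g : ℕ → ℤ) → sumTo n g ≡ sumTo n (λ i → g (n ∸ i))
sumTo-reverse zero    g = refl
sumTo-reverse (suc n) g = begin
  sumTo n g + g (suc n)                           ≡⟨ ℤP.+-comm (sumTo n g) (g (suc n)) ⟩
  g (suc n) + sumTo n g                           ≡⟨ cong (_+_ (g (suc n))) (sumTo-reverse n g) ⟩
  g (suc n) + sumTo n (λ i → g (n ∸ i))           ≡⟨ sumTo-peel n (λ i → g (suc n ∸ i)) ⟨
  sumTo (suc n) (λ i → g (suc n ∸ i))             ∎

sumTo-zero : ∀ n → sumTo n (λ _ → + 0) ≡ + 0
sumTo-zero zero    = refl
sumTo-zero (suc n) = cong (_+ + 0) (sumTo-zero n)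

sumTo-linear : ∀ n c (g h : ℕ → ℤ) →
  sumTo n (λ i → g i + c ℤ.* h i) ≡ sumTo n g + c ℤ.* sumTo n h
sumTo-linear zero    c g h = refl
sumTo-linear (suc n) c g h =
  trans (cong (_+ (g (suc n) + c ℤ.* h (suc n))) (sumTo-linear n c g h))
        (regroup (sumTo n g) (sumTo n h) (g (suc n)) (h (suc n)) c)
  where
  regroup : ∀ G H x y c → (G + c ℤ.* H) + (x + c ℤ.* y) ≡ (G + x) + c ℤ.* (H + y)
  regroup = solve-∀

⊛-cong : ∀ {A A′ B B′ : Series} n → (∀ i → i ≤ n → A i ≡ A′ i) →
         (∀ i → i ≤ n → B i ≡ B′ i) → (A ⊛ B) n ≡ (A′ ⊛ B′) n
⊛-cong n eqA eqB = sumTo-cong n λ i p → cong₂ ℤ._*_ (eqA i p) (eqB (n ∸ i) (ℕP.m∸n≤m n i))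

⊛-comm : ∀ A B n → (A ⊛ B) n ≡ (B ⊛ A) n
⊛-comm A B n = trans (sumTo-reverse n (λ i → A i ℤ.* B (n ∸ i))) (sumTo-cong n λ i p →
  trans (cong (λ j → A (n ∸ i) ℤ.* B j) (ℕP.m∸[m∸n]≡n p)) (ℤP.*-comm (A (n ∸ i)) (B i)))

one-⊛ : ∀ X n → (one ⊛ X) n ≡ X n
one-⊛ X zero    = ℤP.*-identityˡ (X 0)
one-⊛ X (suc n) = begin
  (one ⊛ X) (suc n)                                 ≡⟨ sumTo-peel n (λ i → one i ℤ.* X (suc n ∸ i)) ⟩
  + 1 ℤ.* X (suc n) + sumTo n (λ i → + 0 ℤ.* X (n ∸ i)) ≡⟨ cong₂ _+_ (ℤP.*-identityˡ (X (suc n)))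
                                                          (trans (sumTo-cong n λ i _ → ℤP.*-zeroˡ (X (n ∸ i)))
                                                                 (sumTo-zero n)) ⟩
  X (suc n) + + 0                                   ≡⟨ ℤP.+-identityʳ (X (suc n)) ⟩
  X (suc n)                                         ∎

⊛-linearˡ : ∀ X Y Z c n →
  ((λ i → X i + c ℤ.* Y i) ⊛ Z) n ≡ (X ⊛ Z) n + c ℤ.* (Y ⊛ Z) n
⊛-linearˡ X Y Z c n =
  trans (sumTo-cong n (λ i _ → distrib (X i) (Y i) (Z (n ∸ i)) c)) (sumTo-linear n c _ _)
  where
  distrib : ∀ x y z c → (x + c ℤ.* y) ℤ.* z ≡ x ℤ.* z + c ℤ.* (y ℤ.* z)
  distrib = solve-∀

⊛-linearʳ : ∀ X Y Z c n →
  (Z ⊛ (λ i → X i + c ℤ.* Y i)) n ≡ (Z ⊛ X) n + c ℤ.* (Z ⊛ Y) n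
⊛-linearʳ X Y Z c n =
  trans (sumTo-cong n (λ i _ → distrib (X (n ∸ i)) (Y (n ∸ i)) (Z i) c)) (sumTo-linear n c _ _)
  where
  distrib : ∀ x y z c → z ℤ.* (x + c ℤ.* y) ≡ z ℤ.* x + c ℤ.* (z ℤ.* y)
  distrib = solve-∀

xmul : Series → Series
xmul X zero    = + 0
xmul X (suc n) = X n

shift : ℕ → Series → Series
shift zero    X = X
shift (suc k) X = xmul (shift k X)

shift-cong : ∀ k {X Y : Series} → (∀ i → X i ≡ Y i) → ∀ n → shift k X n ≡ shift k Y n
shift-cong zero    eq n       = eq n
shift-cong (suc k) eq zero    = refl
shift-cong (suc k) eq (suc n) = shift-cong k eq n

shift-below : ∀ k X n → n < k → shift k X n ≡ + 0
shift-below (suc k) X zero    _       = refl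
shift-below (suc k) X (suc n) (s≤s p) = shift-below k X n p

shift-diag : ∀ k X → shift k X k ≡ X 0
shift-diag zero    X = refl
shift-diag (suc k) X = shift-diag k X

xmul-⊛ : ∀ X Y n → (xmul X ⊛ Y) n ≡ xmul (X ⊛ Y) n
xmul-⊛ X Y zero    = ℤP.*-zeroˡ (Y 0)
xmul-⊛ X Y (suc n) =
  trans (sumTo-peel n (λ i → xmul X i ℤ.* Y (suc n ∸ i)))
        (trans (cong (_+ (X ⊛ Y) n) (ℤP.*-zeroˡ (Y (suc n)))) (ℤP.+-identityˡ _))

shift-⊛ : ∀ k X Y n → (shift k X ⊛ Y) n ≡ shift k (X ⊛ Y) n
shift-⊛ zero    X Y n       = refl
shift-⊛ (suc k) X Y zero    = xmul-⊛ (shift k X) Y zero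
shift-⊛ (suc k) X Y (suc n) = trans (xmul-⊛ (shift k X) Y (suc n)) (shift-⊛ k X Y n)

⊛-shift : ∀ k X Y n → (X ⊛ shift k Y) n ≡ shift k (X ⊛ Y) n
⊛-shift k X Y n =
  trans (⊛-comm X (shift k Y) n)
        (trans (shift-⊛ k Y X n) (shift-cong k (⊛-comm Y X) n))

shift-one : ∀ k n → shift k one n ≡ (if k ≡ᵇ n then + 1 else + 0)
shift-one zero    zero    = refl
shift-one zero    (suc n) = refl
shift-one (suc k) zero    = refl
shift-one (suc k) (suc n) = shift-one k n

factor-decomp : ∀ c K n → factor c (suc K) n ≡ one n + - c ℤ.* shift (suc K) one n
factor-decomp c K zero    = sym (cong (_+_ (+ 1)) (ℤP.*-zeroʳ (- c)))
factor-decomp c K (suc n) =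
  trans (select (K ≡ᵇ n)) (cong (λ z → + 0 + - c ℤ.* z) (sym (shift-one K n)))
  where
  select : ∀ b → (if b then - c else + 0) ≡ + 0 + - c ℤ.* (if b then + 1 else + 0)
  select true  = sym (trans (ℤP.+-identityˡ _) (ℤP.*-identityʳ (- c)))
  select false = sym (trans (ℤP.+-identityˡ _) (ℤP.*-zeroʳ (- c)))

mulFactor : ∀ X c K n → (X ⊛ factor c (suc K)) n ≡ X n + - c ℤ.* shift (suc K) X n
mulFactor X c K n = begin
  (X ⊛ factor c k) n                                  ≡⟨ ⊛-comm X (factor c k) n ⟩
  (factor c k ⊛ X) n                                  ≡⟨ ⊛-cong {B = X} {B′ = X} n (λ i _ → factor-decomp c K i) (λ _ _ → refl) ⟩
  ((λ i → one i + - c ℤ.* shift k one i) ⊛ X) n       ≡⟨ ⊛-linearˡ one (shift k one) X (- c) n ⟩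
  (one ⊛ X) n + - c ℤ.* (shift k one ⊛ X) n           ≡⟨ cong₂ (λ u v → u + - c ℤ.* v) (one-⊛ X n)
                                                           (trans (shift-⊛ k one X n) (shift-cong k (one-⊛ X) n)) ⟩
  X n + - c ℤ.* shift k X n                           ∎
  where k = suc K

factorPair : ∀ P Q a b K n → let k = suc K in
  ((P ⊛ factor a k) ⊛ (Q ⊛ factor b k)) n
    ≡ (P ⊛ Q) n + - (a + b) ℤ.* shift k (P ⊛ Q) n + (a ℤ.* b) ℤ.* shift k (shift k (P ⊛ Q)) n
factorPair P Q a b K n = begin
  ((P ⊛ factor a k) ⊛ (Q ⊛ factor b k)) n
    ≡⟨ ⊛-cong n (λ i _ → mulFactor P a K i) (λ i _ → mulFactor Q b K i) ⟩
  ((λ i → P i + - a ℤ.* xP i) ⊛ Q′) n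
    ≡⟨ ⊛-linearˡ P xP Q′ (- a) n ⟩
  (P ⊛ Q′) n + - a ℤ.* (xP ⊛ Q′) n
    ≡⟨ cong₂ (λ u v → u + - a ℤ.* v) (⊛-linearʳ Q xQ P (- b) n) (⊛-linearʳ Q xQ xP (- b) n) ⟩
  ((P ⊛ Q) n + - b ℤ.* (P ⊛ xQ) n) + - a ℤ.* ((xP ⊛ Q) n + - b ℤ.* (xP ⊛ xQ) n)
    ≡⟨ cong₂ (λ u v → ((P ⊛ Q) n + - b ℤ.* u) + - a ℤ.* v) (⊛-shift k P Q n)
             (cong₂ (λ u v → u + - b ℤ.* v) (shift-⊛ k P Q n)
                    (trans (shift-⊛ k P xQ n) (shift-cong k (⊛-shift k P Q) n))) ⟩
  ((P ⊛ Q) n + - b ℤ.* S) + - a ℤ.* (S + - b ℤ.* T)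
    ≡⟨ expand ((P ⊛ Q) n) S T a b ⟩
  (P ⊛ Q) n + - (a + b) ℤ.* S + (a ℤ.* b) ℤ.* T
    ∎
  where
  k  = suc K
  xP = shift k P
  xQ = shift k Q
  Q′ : Series
  Q′ i = Q i + - b ℤ.* xQ i
  S  = shift k (P ⊛ Q) n
  T  = shift k (shift k (P ⊛ Q)) n
  expand : ∀ e s t a b →
    (e + - b ℤ.* s) + - a ℤ.* (s + - b ℤ.* t) ≡ e + - (a + b) ℤ.* s + (a ℤ.* b) ℤ.* t
  expand = solve-∀

partialProd-0 : ∀ c j → partialProd c j 0 ≡ + 1
partialProd-0 c zero    = refl
partialProd-0 c (suc j) = trans (ℤP.*-identityʳ _) (partialProd-0 c j)

partialProd-stable : ∀ c j i → i ≤ j → partialProd c j i ≡ infProd c i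
partialProd-stable c zero    .zero z≤n = refl
partialProd-stable c (suc j) i p with ℕP.m≤n⇒m<n∨m≡n p
... | inj₂ refl    = refl
... | inj₁ (s≤s q) = begin
  partialProd c (suc j) i                                            ≡⟨ mulFactor (partialProd c j) (c (suc j)) j i ⟩
  partialProd c j i + - c (suc j) ℤ.* shift (suc j) (partialProd c j) i ≡⟨ cong (λ z → partialProd c j i + - c (suc j) ℤ.* z)
                                                                          (shift-below (suc j) _ i (s≤s q)) ⟩
  partialProd c j i + - c (suc j) ℤ.* + 0                             ≡⟨ cong (_+_ (partialProd c j i)) (ℤP.*-zeroʳ (- c (suc j))) ⟩
  partialProd c j i + + 0                                             ≡⟨ ℤP.+-identityʳ _ ⟩
  partialProd c j i                                                   ≡⟨ partialProd-stable c j i q ⟩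
  infProd c i                                                         ∎

bothProd : (ℕ → ℤ) → (ℕ → ℤ) → ℕ → Series
bothProd a b M = partialProd a M ⊛ partialProd b M

bothProd-inverse : ∀ f m n → (∀ k → f k ≡ infProd m k) → (∀ k → (f ⊛ infProd n) k ≡ one k) →
                   ∀ N → bothProd m n N N ≡ one N
bothProd-inverse f m n hm hn N =
  trans (sym (⊛-cong N (λ i p → trans (hm i) (sym (partialProd-stable m N i p)))
                       (λ i p → sym (partialProd-stable n N i p))))
        (hn N)

Pure : Parity → Series → Set
Pure p X = ∀ n → parity n ≡ p ⁻¹ → X n ≡ + 0

parity-suc : ∀ n → parity (suc n) ≡ parity n ⁻¹
parity-suc n = ℙP.+-homo-+ 1 n

parity-odd : ∀ j → parity (suc (2 * j)) ≡ 1ℙ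
parity-odd j = trans (parity-suc (2 * j)) (cong _⁻¹ (ℙP.*-homo-* 2 j))

⁻¹-+ : ∀ q p → q ⁻¹ ℙ.+ p ≡ (q ℙ.+ p) ⁻¹
⁻¹-+ 0ℙ p = refl
⁻¹-+ 1ℙ p = sym (ℙP.⁻¹-involutive p)

one-pure : Pure 0ℙ one
one-pure zero    ()
one-pure (suc n) _ = refl

xmul-pure : ∀ {p X} → Pure p X → Pure (p ⁻¹) (xmul X)
xmul-pure pure zero    _   = refl
xmul-pure pure (suc n) par = pure n (ℙP.⁻¹-injective (trans (sym (parity-suc n)) par))

shift-pure : ∀ {p q X} → Pure p X → ∀ k → parity k ℙ.+ p ≡ q → Pure q (shift k X)
shift-pure pure zero    refl = pure
shift-pure {p} pure (suc k) refl =
  subst (λ r → Pure r (shift (suc k) _))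
        (sym (trans (cong (ℙ._+ p) (parity-suc k)) (⁻¹-+ (parity k) p)))
        (xmul-pure (shift-pure pure k refl))

pure-step : ∀ {E} k a b → Pure 0ℙ E → (parity k ≡ 1ℙ → a + b ≡ + 0) →
  Pure 0ℙ (λ n → E n + - (a + b) ℤ.* shift k E n + (a ℤ.* b) ℤ.* shift k (shift k E) n)
pure-step {E} k a b even oddSum n odd = begin
  E n + - (a + b) ℤ.* shift k E n + (a ℤ.* b) ℤ.* shift k (shift k E) n
    ≡⟨ cong₂ _+_ (cong₂ _+_ (even n odd) middle)
                 (cong ((a ℤ.* b) ℤ.*_) (shift-pure (shift-pure even k refl) k (double (parity k)) n odd)) ⟩
  + 0 + + 0 + (a ℤ.* b) ℤ.* + 0
    ≡⟨ cong (_+_ (+ 0 + + 0)) (ℤP.*-zeroʳ (a ℤ.* b)) ⟩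
  + 0 ∎
  where
  double : ∀ p → p ℙ.+ (p ℙ.+ 0ℙ) ≡ 0ℙ
  double 0ℙ = refl
  double 1ℙ = refl
  middle : - (a + b) ℤ.* shift k E n ≡ + 0
  middle = byParity (parity k) refl
    where
    byParity : ∀ p → parity k ≡ p → - (a + b) ℤ.* shift k E n ≡ + 0
    byParity 0ℙ kEven = trans (cong (- (a + b) ℤ.*_) (shift-pure even k (cong (ℙ._+ 0ℙ) kEven) n odd))
                              (ℤP.*-zeroʳ (- (a + b)))
    byParity 1ℙ kOdd  = trans (cong (λ s → - s ℤ.* shift k E n) (oddSum kOdd)) (ℤP.*-zeroˡ (shift k E n))

OddAgree : (ℕ → ℤ) → (ℕ → ℤ) → ℕ → Set
OddAgree a b M = ∀ k → k ≤ M → parity k ≡ 1ℙ → a k + b k ≡ + 0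

bothProd-pure : ∀ a b M → OddAgree a b M → Pure 0ℙ (bothProd a b M)
bothProd-pure a b zero    _     n odd = trans (one-⊛ one n) (one-pure n odd)
bothProd-pure a b (suc M) agree n odd =
  trans (factorPair (partialProd a M) (partialProd b M) (a (suc M)) (b (suc M)) M n)
        (pure-step (suc M) (a (suc M)) (b (suc M))
                   (bothProd-pure a b M (λ k p → agree k (ℕP.m≤n⇒m≤1+n p)))
                   (agree (suc M) ℕP.≤-refl) n odd)

-- For odd N = M + 1, the coefficient of x^N in bothProd a b N is -(a_N + b_N).
agree-next : ∀ a b M → OddAgree a b M → parity (suc M) ≡ 1ℙ →
             bothProd a b (suc M) (suc M) ≡ + 0 → a (suc M) + b (suc M) ≡ + 0
agree-next a b M agree odd vanish = ℤP.neg-injective (sym (begin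
  + 0                                                   ≡⟨ vanish ⟨
  bothProd a b N N                                      ≡⟨ factorPair (partialProd a M) (partialProd b M) (a N) (b N) M N ⟩
  E N + - s ℤ.* shift N E N + c ℤ.* shift N (shift N E) N
    ≡⟨ cong₂ _+_ (cong₂ (λ u v → u + - s ℤ.* v) (bothProd-pure a b M agree N odd) E₀)
                 (cong (c ℤ.*_) (shift-diag N (shift N E))) ⟩
  + 0 + - s ℤ.* + 1 + c ℤ.* + 0                         ≡⟨ collect s c ⟩
  - s                                                   ∎))
  where
  N = suc M
  E = bothProd a b M
  s = a N + b N
  c = a N ℤ.* b N
  E₀ : shift N E N ≡ + 1
  E₀ = trans (shift-diag N E) (cong₂ ℤ._*_ (partialProd-0 a M) (partialProd-0 b M))
  collect : ∀ s c → + 0 + - s ℤ.* + 1 + c ℤ.* + 0 ≡ - s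
  collect = solve-∀

oddAgree : ∀ a b → (∀ N → bothProd a b N N ≡ one N) → ∀ M → OddAgree a b M
oddAgree a b inverse zero    .zero z≤n ()
oddAgree a b inverse (suc M) k    p   odd with ℕP.m≤n⇒m<n∨m≡n p
... | inj₁ (s≤s q) = oddAgree a b inverse M k q odd
... | inj₂ refl    = agree-next a b M (oddAgree a b inverse M) odd (inverse (suc M))

-- The hypotheses on d and on the coefficients of f of degree 1 and 2 are not
-- needed: the identity m_k = -n_k (k odd) holds for any such pair of factorizations.
mainTheorem2 : (d : ℤ) (f : Series) →
    f 0 ≡ + 1 → f 1 ≡ -[1+ 0 ] → f 2 ≡ - d →
    (m n : ℕ → ℤ) →
    (∀ k → f k ≡ infProd m k) →
    (∀ k → (f ⊛ infProd n) k ≡ one k) →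
    ∀ j → m (suc (2 * j)) ≡ - n (suc (2 * j))
mainTheorem2 d f _ _ _ m n hm hn j =
  inverseˡ-unique (m k) (n k) (oddAgree m n (bothProd-inverse f m n hm hn) k k ℕP.≤-refl (parity-odd j))
  where k = suc (2 * j)
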